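{- Let $\mathcal B\subseteq\mathcal P([n])$ be a simply rooted family with $|\mathcal B|=m$, and let $m'$ be the number of sets $B\in\mathcal B$ with $d_{\mathcal B}(B)=B$. Then $\|\mathcal B\|\le\|\mathcal I(m)\|+m-m'$.
   Context: $\mathcal B$ is simply rooted if for every nonempty $B\in\mathcal B$ there is $b\in B$ with $\{C:\{b\}\subseteq C\subseteq B\}\subseteq\mathcal B$. For $\mathcal F\subseteq\mathcal P([n])$ and $i\in[n]$: $d_{(i,\mathcal F)}(F)=F\setminus\{i\}$ if $i\in F$ and $F\setminus\{i\}\notin\mathcal F$, else $F$; $d_i(\mathcal F)=\{d_{(i,\mathcal F)}(F):F\in\mathcal F\}$. With $\mathcal B_0=\mathcal B$, $\mathcal B_k=d_k(\mathcal B_{k-1})$, define for $B\in\mathcal B$: $d_{\mathcal B}(B)=d_{(n,\mathcal B_{n-1})}\circ\cdots\circ d_{(1,\mathcal B_0)}(B)$ (the image of $B$ after successively applying $d_1,\dots,d_n$). $\|\mathcal F\|=\sum_{F\in\mathcal F}|F|$. The colex order: $A<B$ iff $\max(A\triangle B)\in B$; $\mathcal I(m)$ is the family of the first $m$ finite sets of positive integers in this order. -}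

module Defs where

open import Data.Nat using (ℕ; zero; suc; _+_)
open import Data.Bool using (Bool; true; false; _∧_; _∨_; not; if_then_else_)
open import Data.Fin using (Fin)
open import Data.Fin.Subset using (Subset; _∈_; _⊆_; Nonempty; _-_; ∣_∣; outside; inside)
open import Data.Vec using (Vec; []; _∷_; lookup)
open import Data.List using (List; []; _∷_; _++_; map)
import Data.List as List
open import Data.Nat.ListAction using (sum)
open import Data.Bool.ListAction using (any)
open import Data.Vec using (allFin; toList)
open import Data.Product using (Σ; _×_; ∃)
open import Relation.Binary.PropositionalEquality using (_≡_)

-- Subsets of [n] are 'Subset n' (Fin index i represents element i+1).
-- A family F ⊆ P([n]) is a boolean membership predicate.
Family : ℕ → Set
Family n = Subset n → Bool

_=ˢ_ : ∀ {n} → Subset n → Subset n → Bool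
[] =ˢ [] = true
(x ∷ xs) =ˢ (y ∷ ys) = (x Data.Bool.∧ y ∨ not x ∧ not y) ∧ (xs =ˢ ys)

allSubsets : (n : ℕ) → List (Subset n)
allSubsets zero = [] ∷ []
allSubsets (suc n) = map (outside ∷_) (allSubsets n) ++ map (inside ∷_) (allSubsets n)

count : ∀ {n} → (Subset n → Bool) → ℕ
count {n} P = List.length (List.filterᵇ P (allSubsets n))

card : ∀ {n} → Family n → ℕ
card 𝓕 = count 𝓕

weight : ∀ {n} → Family n → ℕ
weight {n} 𝓕 = sum (map ∣_∣ (List.filterᵇ 𝓕 (allSubsets n)))

_∈ᵇ_ : ∀ {n} → Fin n → Subset n → Bool
i ∈ᵇ F = lookup F i

dElem : ∀ {n} → Fin n → Family n → Subset n → Subset n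
dElem i 𝓕 F = if (i ∈ᵇ F) ∧ not (𝓕 (F - i)) then F - i else F

dFam : ∀ {n} → Fin n → Family n → Family n
dFam {n} i 𝓕 G = any (λ F → 𝓕 F ∧ (dElem i 𝓕 F =ˢ G)) (allSubsets n)

dSeq : ∀ {n} → List (Fin n) → Family n → Subset n → Subset n
dSeq [] 𝓕 B = B
dSeq (i ∷ is) 𝓕 B = dSeq is (dFam i 𝓕) (dElem i 𝓕 B)

-- d_B(B) = d_(n,B_{n-1}) ∘ ... ∘ d_(1,B_0) (B), indices 1..n in increasing order
dB : ∀ {n} → Family n → Subset n → Subset n
dB {n} 𝓑 B = dSeq (toList (allFin n)) 𝓑 B

SimplyRooted : ∀ {n} → Family n → Set
SimplyRooted {n} 𝓑 =
  ∀ (B : Subset n) → 𝓑 B ≡ true → Nonempty B →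
  ∃ λ b → b ∈ B × (∀ (C : Subset n) → b ∈ C → C ⊆ B → 𝓑 C ≡ true)

-- colex order on subsets of [k]: A < B iff max(A △ B) ∈ B
colexLt : ∀ {k} → Subset k → Subset k → Bool
colexLt [] [] = false
colexLt (x ∷ xs) (y ∷ ys) = if xs =ˢ ys then not x ∧ y else colexLt xs ys

-- I(m): the first m finite sets of positive integers in colex order.
-- All of them are subsets of [m], and subsets of [m] form an initial segment
-- of the colex order, so I(m) = { F ⊆ [m] : #{G ⊆ [m] : G <colex F} < m }.
I : (m : ℕ) → Family m
I m F = Data.Nat._<ᵇ_ (count (λ G → colexLt G F)) m

weightI : ℕ → ℕ
weightI m = weight (I m)

{-# OPTIONS --safe #-}

-- It suffices to show ‖𝓑‖ + m′(𝓑) ≤ ‖I(m)‖ + m, where m′(𝓖) counts the fixed points of d_𝓖; we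
-- argue by induction on n. Split 𝓖 ⊆ P([n+1]) along the element 1 and let 𝓤 and 𝓝 be the union
-- and the intersection of its two fibres. Then d₁ maps 𝓖 onto 𝓤 ∪ {{1} ∪ C : C ∈ 𝓝}, d_𝓖 acts on
-- the two parts as d_𝓤 and d_𝓝, and 𝓤 and 𝓝 are again simply rooted. The sets {1} ∪ C ∈ 𝓖 with
-- C ∉ 𝓖 are moved by d₁, so they are not fixed by d_𝓖; but their root must be 1, which makes C a
-- fixed point of d_𝓤. Counting gives
--   ‖𝓖‖ + m′(𝓖) = (‖𝓤‖ + m′(𝓤)) + (‖𝓝‖ + m′(𝓝)) + |𝓝|,
-- and the induction closes by ‖I(a)‖ + ‖I(b)‖ + min(a, b) ≤ ‖I(a + b)‖ with a = |𝓤| ≥ b = |𝓝|.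
-- That inequality is proved for the colex initial segments of P([n]) by induction on n, using
-- ‖I(2x)‖ = 2‖I(x)‖ + x and ‖I(2x+1)‖ = ‖I(x+1)‖ + ‖I(x)‖ + x.

module Submission where

open import Data.Bool using (Bool; true; false; _∧_; _∨_; not; if_then_else_)
open import Data.Bool.ListAction using (any; or)
open import Data.Bool.Properties
  using (∨-assoc; ∨-identityʳ; ∨-zeroʳ; ∧-identityʳ; ∧-zeroʳ; ∧-comm; ∧-conicalˡ; ∧-conicalʳ;
         if-float; if-eta; if-not; if-cong)
open import Data.Fin using (zero; suc)
open import Data.Fin.Subset using (Subset; outside; inside; _⊆_; _-_; ∣_∣)
open import Data.Fin.Subset.Properties using (p─⊥≡p; out⊆; s⊆s; ⊆-refl)
open import Data.List using (List; []; _∷_; _++_; map; length; filterᵇ)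
open import Data.List.Properties using (map-++; map-∘; map-cong)
open import Data.Nat
  using (ℕ; zero; suc; _+_; _*_; _^_; _∸_; _≤_; _<_; _≤′_; _<ᵇ_; z≤n; s≤s; s≤s⁻¹; ≤′-refl; ≤′-step;
         ⌊_/2⌋; ⌈_/2⌉)
open import Data.Nat.ListAction using (sum)
open import Data.Nat.ListAction.Properties using (sum-++)
open import Data.Nat.Properties
open import Algebra.Properties.CommutativeSemigroup +-commutativeSemigroup using (interchange; xy∙z≈xz∙y)
open import Data.Nat.Tactic.RingSolver using (solve-∀)
open import Data.Product using (_,_)
open import Data.Vec using ([]; _∷_; here; there; allFin; toList; lookup)
open import Data.Vec.Properties using (toList-map; tabulate-∘)
open import Function using (_∘_; id)
open import Relation.Binary.PropositionalEquality
open import Relation.Nullary.Reflects using (det; fromEquivalence)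

open import Defs

private
  variable
    n : ℕ
    A : Set

=ˢ⇒≡ : ∀ {n} (G C : Subset n) → (G =ˢ C) ≡ true → G ≡ C
=ˢ⇒≡ []          []          _   = refl
=ˢ⇒≡ (false ∷ G) (false ∷ C) G=C = cong (false ∷_) (=ˢ⇒≡ G C G=C)
=ˢ⇒≡ (true ∷ G)  (true ∷ C)  G=C = cong (true ∷_) (=ˢ⇒≡ G C G=C)

=ˢ-refl : ∀ (C : Subset n) → (C =ˢ C) ≡ true
=ˢ-refl []          = refl
=ˢ-refl (false ∷ C) = =ˢ-refl C
=ˢ-refl (true ∷ C)  = =ˢ-refl C

-- Sums over the cube

cubeSum : ∀ n → (Subset n → ℕ) → ℕ
cubeSum zero    f = f []
cubeSum (suc n) f = cubeSum n (f ∘ (outside ∷_)) + cubeSum n (f ∘ (inside ∷_))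

cubeSum-cong : ∀ n {f g : Subset n → ℕ} → f ≗ g → cubeSum n f ≡ cubeSum n g
cubeSum-cong zero    f≗g = f≗g []
cubeSum-cong (suc n) f≗g =
  cong₂ _+_ (cubeSum-cong n (f≗g ∘ (outside ∷_))) (cubeSum-cong n (f≗g ∘ (inside ∷_)))

cubeSum-mono : ∀ n {f g : Subset n → ℕ} → (∀ C → f C ≤ g C) → cubeSum n f ≤ cubeSum n g
cubeSum-mono zero    f≤g = f≤g []
cubeSum-mono (suc n) f≤g =
  +-mono-≤ (cubeSum-mono n (f≤g ∘ (outside ∷_))) (cubeSum-mono n (f≤g ∘ (inside ∷_)))

cubeSum-+ : ∀ n {h f g : Subset n → ℕ} → (∀ C → h C ≡ f C + g C) →
            cubeSum n h ≡ cubeSum n f + cubeSum n g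
cubeSum-+ zero    h≡f+g = h≡f+g []
cubeSum-+ (suc n) {f = f} {g} h≡f+g =
  trans (cong₂ _+_ (cubeSum-+ n (h≡f+g ∘ (outside ∷_))) (cubeSum-+ n (h≡f+g ∘ (inside ∷_))))
        (interchange (cubeSum n (f ∘ (outside ∷_))) (cubeSum n (g ∘ (outside ∷_)))
                     (cubeSum n (f ∘ (inside ∷_))) (cubeSum n (g ∘ (inside ∷_))))

cubeSum-zero : ∀ n → cubeSum n (λ _ → 0) ≡ 0
cubeSum-zero zero    = refl
cubeSum-zero (suc n) = cong₂ _+_ (cubeSum-zero n) (cubeSum-zero n)

cubeSum-=ˢ : ∀ {n} (C : Subset n) k → cubeSum n (λ G → if G =ˢ C then k else 0) ≡ k
cubeSum-=ˢ []          k = refl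
cubeSum-=ˢ {suc n} (false ∷ C) k = trans (cong₂ _+_ (cubeSum-=ˢ C k) (cubeSum-zero n)) (+-identityʳ k)
cubeSum-=ˢ {suc n} (true ∷ C)  k =
  trans (cong (_+ cubeSum n (λ G → if G =ˢ C then k else 0)) (cubeSum-zero n)) (cubeSum-=ˢ C k)

sumOver : Family n → (Subset n → ℕ) → ℕ
sumOver {n} 𝓕 f = cubeSum n (λ C → if 𝓕 C then f C else 0)

#_ : Family n → ℕ
# 𝓕 = sumOver 𝓕 (λ _ → 1)

‖_‖ : Family n → ℕ
‖ 𝓕 ‖ = sumOver 𝓕 ∣_∣

sumOver-cong : ∀ {𝓕 𝓖 : Family n} f → 𝓕 ≗ 𝓖 → sumOver 𝓕 f ≡ sumOver 𝓖 f
sumOver-cong f 𝓕≗𝓖 = cubeSum-cong _ (if-cong ∘ 𝓕≗𝓖)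

sumOver-mono : ∀ {𝓕 𝓖 : Family n} f → (∀ C → 𝓕 C ≡ true → 𝓖 C ≡ true) → sumOver 𝓕 f ≤ sumOver 𝓖 f
sumOver-mono {𝓕 = 𝓕} {𝓖} f 𝓕⊆𝓖 = cubeSum-mono _ pointwise
  where
  pointwise : ∀ C → (if 𝓕 C then f C else 0) ≤ (if 𝓖 C then f C else 0)
  pointwise C with 𝓕 C | 𝓕⊆𝓖 C
  ... | false | _ = z≤n
  ... | true  | C∈𝓖 rewrite C∈𝓖 refl = ≤-refl

sumOver-∪-∩ : ∀ (𝓕 𝓖 : Family n) f →
  sumOver (λ C → 𝓕 C ∨ 𝓖 C) f + sumOver (λ C → 𝓕 C ∧ 𝓖 C) f ≡ sumOver 𝓕 f + sumOver 𝓖 f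
sumOver-∪-∩ {n} 𝓕 𝓖 f =
  trans (sym (cubeSum-+ n {f = indicator (λ C → 𝓕 C ∨ 𝓖 C)} {g = indicator (λ C → 𝓕 C ∧ 𝓖 C)}
                         λ _ → refl))
        (cubeSum-+ n pointwise)
  where
  indicator : Family n → Subset n → ℕ
  indicator 𝓗 C = if 𝓗 C then f C else 0
  pointwise : ∀ C → (if 𝓕 C ∨ 𝓖 C then f C else 0) + (if 𝓕 C ∧ 𝓖 C then f C else 0)
                  ≡ (if 𝓕 C then f C else 0) + (if 𝓖 C then f C else 0)
  pointwise C with 𝓕 C | 𝓖 C
  ... | true  | _     = refl
  ... | false | true  = +-comm (f C) 0
  ... | false | false = refl

sumOver-split : ∀ (𝓕 𝓖 : Family n) f →
  sumOver 𝓕 f ≡ sumOver (λ C → 𝓕 C ∧ 𝓖 C) f + sumOver (λ C → 𝓕 C ∧ not (𝓖 C)) f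
sumOver-split 𝓕 𝓖 f = cubeSum-+ _ pointwise
  where
  pointwise : ∀ C → (if 𝓕 C then f C else 0)
                  ≡ (if 𝓕 C ∧ 𝓖 C then f C else 0) + (if 𝓕 C ∧ not (𝓖 C) then f C else 0)
  pointwise C with 𝓕 C | 𝓖 C
  ... | true  | true  = sym (+-identityʳ (f C))
  ... | true  | false = refl
  ... | false | _     = refl

sumOver-suc : ∀ (𝓕 : Family n) f → sumOver 𝓕 (λ C → suc (f C)) ≡ sumOver 𝓕 f + # 𝓕
sumOver-suc 𝓕 f = cubeSum-+ _ pointwise
  where
  pointwise : ∀ C → (if 𝓕 C then suc (f C) else 0) ≡ (if 𝓕 C then f C else 0) + (if 𝓕 C then 1 else 0)
  pointwise C with 𝓕 C
  ... | true  = +-comm 1 (f C)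
  ... | false = refl

sum-map-filterᵇ : ∀ (P : A → Bool) (f : A → ℕ) xs →
  sum (map f (filterᵇ P xs)) ≡ sum (map (λ x → if P x then f x else 0) xs)
sum-map-filterᵇ P f []       = refl
sum-map-filterᵇ P f (x ∷ xs) with P x
... | true  = cong (f x +_) (sum-map-filterᵇ P f xs)
... | false = sum-map-filterᵇ P f xs

length≡sum-map-1 : ∀ (xs : List A) → length xs ≡ sum (map (λ _ → 1) xs)
length≡sum-map-1 []       = refl
length≡sum-map-1 (x ∷ xs) = cong suc (length≡sum-map-1 xs)

sum-map-allSubsets : ∀ n (f : Subset n → ℕ) → sum (map f (allSubsets n)) ≡ cubeSum n f
sum-map-allSubsets zero    f = +-identityʳ (f [])
sum-map-allSubsets (suc n) f = begin
  sum (map f (map (outside ∷_) S ++ map (inside ∷_) S))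
    ≡⟨ cong sum (map-++ f (map (outside ∷_) S) _) ⟩
  sum (map f (map (outside ∷_) S) ++ map f (map (inside ∷_) S))
    ≡⟨ sum-++ (map f (map (outside ∷_) S)) _ ⟩
  sum (map f (map (outside ∷_) S)) + sum (map f (map (inside ∷_) S))
    ≡⟨ cong₂ _+_ (cong sum (sym (map-∘ S))) (cong sum (sym (map-∘ S))) ⟩
  sum (map (f ∘ (outside ∷_)) S) + sum (map (f ∘ (inside ∷_)) S)
    ≡⟨ cong₂ _+_ (sum-map-allSubsets n (f ∘ (outside ∷_))) (sum-map-allSubsets n (f ∘ (inside ∷_))) ⟩
  cubeSum (suc n) f ∎
  where
  open ≡-Reasoning
  S = allSubsets n

weight≡‖‖ : ∀ (𝓕 : Family n) → weight 𝓕 ≡ ‖ 𝓕 ‖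
weight≡‖‖ {n} 𝓕 = trans (sum-map-filterᵇ 𝓕 ∣_∣ (allSubsets n)) (sum-map-allSubsets n _)

count≡# : ∀ (𝓕 : Family n) → count 𝓕 ≡ # 𝓕
count≡# {n} 𝓕 = begin
  length (filterᵇ 𝓕 (allSubsets n))          ≡⟨ length≡sum-map-1 (filterᵇ 𝓕 (allSubsets n)) ⟩
  sum (map (λ _ → 1) (filterᵇ 𝓕 (allSubsets n))) ≡⟨ sum-map-filterᵇ 𝓕 _ (allSubsets n) ⟩
  sum (map (λ C → if 𝓕 C then 1 else 0) (allSubsets n)) ≡⟨ sum-map-allSubsets n _ ⟩
  # 𝓕 ∎
  where open ≡-Reasoning

-- Fibres along the first coordinate

fibre : Bool → Family (suc n) → Family n
fibre x 𝓖 C = 𝓖 (x ∷ C)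

fibreUnion fibreInter : Family (suc n) → Family n
fibreUnion 𝓖 C = 𝓖 (outside ∷ C) ∨ 𝓖 (inside ∷ C)
fibreInter 𝓖 C = 𝓖 (outside ∷ C) ∧ 𝓖 (inside ∷ C)

moved : Family (suc n) → Family n
moved 𝓖 C = 𝓖 (inside ∷ C) ∧ not (𝓖 (outside ∷ C))

#-fibres : ∀ (𝓖 : Family (suc n)) {𝓐 𝓑 : Family n} →
  fibre outside 𝓖 ≗ 𝓐 → fibre inside 𝓖 ≗ 𝓑 → # 𝓖 ≡ # 𝓐 + # 𝓑
#-fibres 𝓖 𝓖₀≗𝓐 𝓖₁≗𝓑 = cong₂ _+_ (sumOver-cong _ 𝓖₀≗𝓐) (sumOver-cong _ 𝓖₁≗𝓑)

‖‖-fibres : ∀ (𝓖 : Family (suc n)) {𝓐 𝓑 : Family n} →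
  fibre outside 𝓖 ≗ 𝓐 → fibre inside 𝓖 ≗ 𝓑 → ‖ 𝓖 ‖ ≡ ‖ 𝓐 ‖ + (‖ 𝓑 ‖ + # 𝓑)
‖‖-fibres 𝓖 𝓖₀≗𝓐 𝓖₁≗𝓑 =
  cong₂ _+_ (sumOver-cong _ 𝓖₀≗𝓐)
            (trans (sumOver-suc (fibre inside 𝓖) ∣_∣)
                   (cong₂ _+_ (sumOver-cong _ 𝓖₁≗𝓑) (sumOver-cong _ 𝓖₁≗𝓑)))

#-compress : ∀ (𝓖 : Family (suc n)) → # 𝓖 ≡ # (fibreUnion 𝓖) + # (fibreInter 𝓖)
#-compress 𝓖 = sym (sumOver-∪-∩ (fibre outside 𝓖) (fibre inside 𝓖) _)

‖‖-compress : ∀ (𝓖 : Family (suc n)) →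
  ‖ 𝓖 ‖ ≡ ‖ fibreUnion 𝓖 ‖ + ‖ fibreInter 𝓖 ‖ + (# (fibreInter 𝓖) + # (moved 𝓖))
‖‖-compress 𝓖 = begin
  ‖ 𝓖 ‖                            ≡⟨ ‖‖-fibres 𝓖 (λ _ → refl) (λ _ → refl) ⟩
  ‖ 𝓖₀ ‖ + (‖ 𝓖₁ ‖ + # 𝓖₁)         ≡⟨ +-assoc ‖ 𝓖₀ ‖ _ _ ⟨
  ‖ 𝓖₀ ‖ + ‖ 𝓖₁ ‖ + # 𝓖₁           ≡⟨ cong (_+ # 𝓖₁) (sumOver-∪-∩ 𝓖₀ 𝓖₁ ∣_∣) ⟨
  ‖ fibreUnion 𝓖 ‖ + ‖ fibreInter 𝓖 ‖ + # 𝓖₁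
    ≡⟨ cong (‖ fibreUnion 𝓖 ‖ + ‖ fibreInter 𝓖 ‖ +_) (sumOver-split 𝓖₁ 𝓖₀ _) ⟩
  ‖ fibreUnion 𝓖 ‖ + ‖ fibreInter 𝓖 ‖ + (# (λ C → 𝓖₁ C ∧ 𝓖₀ C) + # (moved 𝓖))
    ≡⟨ cong (λ k → ‖ fibreUnion 𝓖 ‖ + ‖ fibreInter 𝓖 ‖ + (k + # (moved 𝓖)))
            (sumOver-cong _ λ C → ∧-comm (𝓖₁ C) (𝓖₀ C)) ⟩
  ‖ fibreUnion 𝓖 ‖ + ‖ fibreInter 𝓖 ‖ + (# (fibreInter 𝓖) + # (moved 𝓖)) ∎
  where
  open ≡-Reasoning
  𝓖₀ 𝓖₁ : Family _
  𝓖₀ = fibre outside 𝓖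
  𝓖₁ = fibre inside 𝓖

#fibreInter≤#fibreUnion : ∀ (𝓖 : Family (suc n)) → # (fibreInter 𝓖) ≤ # (fibreUnion 𝓖)
#fibreInter≤#fibreUnion 𝓖 =
  sumOver-mono _ λ C C∈𝓝 → cong (_∨ 𝓖 (inside ∷ C)) (∧-conicalˡ (𝓖 (outside ∷ C)) _ C∈𝓝)

-- The compressions d_i

any-++ : ∀ (p : A → Bool) xs ys → any p (xs ++ ys) ≡ any p xs ∨ any p ys
any-++ p []       ys = refl
any-++ p (x ∷ xs) ys = trans (cong (p x ∨_) (any-++ p xs ys)) (sym (∨-assoc (p x) _ _))

any-cong : ∀ {p q : A → Bool} → p ≗ q → ∀ xs → any p xs ≡ any q xs
any-cong p≗q xs = cong or (map-cong p≗q xs)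

any-allSubsets : ∀ n (p : Subset (suc n) → Bool) →
  any p (allSubsets (suc n)) ≡ any (p ∘ (outside ∷_)) (allSubsets n) ∨ any (p ∘ (inside ∷_)) (allSubsets n)
any-allSubsets n p =
  trans (any-++ p (map (outside ∷_) (allSubsets n)) _)
        (cong₂ _∨_ (cong or (sym (map-∘ (allSubsets n)))) (cong or (sym (map-∘ (allSubsets n)))))

any-false : ∀ n {p : Subset n → Bool} → (∀ C → p C ≡ false) → any p (allSubsets n) ≡ false
any-false n {p} p≡false = trans (any-cong p≡false (allSubsets n)) (any-⊥ (allSubsets n))
  where
  any-⊥ : ∀ (xs : List (Subset n)) → any (λ _ → false) xs ≡ false
  any-⊥ []       = refl
  any-⊥ (_ ∷ xs) = any-⊥ xs

any-=ˢ : ∀ {n} (P : Family n) C → any (λ F → P F ∧ (F =ˢ C)) (allSubsets n) ≡ P C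
any-=ˢ         P []          = trans (∨-identityʳ _) (∧-identityʳ (P []))
any-=ˢ {suc n} P (false ∷ C) =
  trans (any-allSubsets n _)
        (trans (cong₂ _∨_ (any-=ˢ (P ∘ (outside ∷_)) C) (any-false n (λ F → ∧-zeroʳ (P (inside ∷ F)))))
               (∨-identityʳ _))
any-=ˢ {suc n} P (true ∷ C)  =
  trans (any-allSubsets n _)
        (cong₂ _∨_ (any-false n (λ F → ∧-zeroʳ (P (outside ∷ F)))) (any-=ˢ (P ∘ (inside ∷_)) C))

compressedFibre : Bool → Family (suc n) → Family n
compressedFibre false = fibreUnion
compressedFibre true  = fibreInter

dElem-zero-inside : ∀ (𝓖 : Family (suc n)) B →
  dElem zero 𝓖 (inside ∷ B) ≡ (if 𝓖 (outside ∷ B) then inside ∷ B else outside ∷ B)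
dElem-zero-inside 𝓖 B =
  trans (cong (λ E → if not (𝓖 (outside ∷ E)) then outside ∷ E else inside ∷ B) (p─⊥≡p B))
        (if-not (𝓖 (outside ∷ B)))

dElem-suc : ∀ i (𝓖 : Family (suc n)) x B → dElem (suc i) 𝓖 (x ∷ B) ≡ x ∷ dElem i (fibre x 𝓖) B
dElem-suc i 𝓖 x B = sym (if-float (x ∷_) (lookup B i ∧ not (𝓖 (x ∷ (B - i)))))

fibre-dFam-zero : ∀ x (𝓖 : Family (suc n)) → fibre x (dFam zero 𝓖) ≗ compressedFibre x 𝓖
fibre-dFam-zero {n} false 𝓖 C =
  trans (any-allSubsets n _)
        (trans (cong₂ _∨_ (any-=ˢ (fibre outside 𝓖) C)
                          (trans (any-cong lowered (allSubsets n)) (any-=ˢ (moved 𝓖) C)))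
               (absorb (𝓖 (outside ∷ C))))
  where
  lowered : ∀ D → (𝓖 (inside ∷ D) ∧ (dElem zero 𝓖 (inside ∷ D) =ˢ (outside ∷ C)))
                ≡ moved 𝓖 D ∧ (D =ˢ C)
  lowered D rewrite dElem-zero-inside 𝓖 D with 𝓖 (outside ∷ D) | 𝓖 (inside ∷ D)
  ... | true  | true  = refl
  ... | true  | false = refl
  ... | false | true  = refl
  ... | false | false = refl
  absorb : ∀ a → a ∨ (𝓖 (inside ∷ C) ∧ not a) ≡ a ∨ 𝓖 (inside ∷ C)
  absorb true  = refl
  absorb false = ∧-identityʳ _
fibre-dFam-zero {n} true  𝓖 C =
  trans (any-allSubsets n _)
        (cong₂ _∨_ (any-false n (λ D → ∧-zeroʳ (𝓖 (outside ∷ D))))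
                   (trans (any-cong kept (allSubsets n)) (any-=ˢ (fibreInter 𝓖) C)))
  where
  kept : ∀ D → (𝓖 (inside ∷ D) ∧ (dElem zero 𝓖 (inside ∷ D) =ˢ (inside ∷ C)))
             ≡ fibreInter 𝓖 D ∧ (D =ˢ C)
  kept D rewrite dElem-zero-inside 𝓖 D with 𝓖 (outside ∷ D) | 𝓖 (inside ∷ D)
  ... | true  | true  = refl
  ... | true  | false = refl
  ... | false | b     = ∧-zeroʳ b

fibre-dFam-suc : ∀ i x (𝓖 : Family (suc n)) → fibre x (dFam (suc i) 𝓖) ≗ dFam i (fibre x 𝓖)
fibre-dFam-suc {n} i x 𝓖 C = trans (any-allSubsets n _) (select x)
  where
  S = allSubsets n
  shifted : ∀ y z D → (𝓖 (y ∷ D) ∧ (dElem (suc i) 𝓖 (y ∷ D) =ˢ (z ∷ C)))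
                     ≡ 𝓖 (y ∷ D) ∧ ((y ∷ dElem i (fibre y 𝓖) D) =ˢ (z ∷ C))
  shifted y z D = cong (λ E → 𝓖 (y ∷ D) ∧ (E =ˢ (z ∷ C))) (dElem-suc i 𝓖 y D)
  select : ∀ z → any (λ D → 𝓖 (outside ∷ D) ∧ (dElem (suc i) 𝓖 (outside ∷ D) =ˢ (z ∷ C))) S
               ∨ any (λ D → 𝓖 (inside ∷ D) ∧ (dElem (suc i) 𝓖 (inside ∷ D) =ˢ (z ∷ C))) S
               ≡ dFam i (fibre z 𝓖) C
  select false =
    trans (cong₂ _∨_ (any-cong (shifted outside outside) S)
                     (trans (any-cong (shifted inside outside) S) (any-false n λ D → ∧-zeroʳ (𝓖 (inside ∷ D)))))
          (∨-identityʳ _)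
  select true  =
    cong₂ _∨_ (trans (any-cong (shifted outside inside) S) (any-false n λ D → ∧-zeroʳ (𝓖 (outside ∷ D))))
              (any-cong (shifted inside inside) S)

dElem-cong : ∀ i {𝓕 𝓕′ : Family n} → 𝓕 ≗ 𝓕′ → dElem i 𝓕 ≗ dElem i 𝓕′
dElem-cong i 𝓕≗𝓕′ B rewrite 𝓕≗𝓕′ (B - i) = refl

dFam-cong : ∀ i {𝓕 𝓕′ : Family n} → 𝓕 ≗ 𝓕′ → dFam i 𝓕 ≗ dFam i 𝓕′
dFam-cong {n} i 𝓕≗𝓕′ G =
  any-cong (λ F → cong₂ (λ b E → b ∧ (E =ˢ G)) (𝓕≗𝓕′ F) (dElem-cong i 𝓕≗𝓕′ F)) (allSubsets n)

dSeq-cong : ∀ is {𝓕 𝓕′ : Family n} → 𝓕 ≗ 𝓕′ → dSeq is 𝓕 ≗ dSeq is 𝓕′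
dSeq-cong []       𝓕≗𝓕′ B = refl
dSeq-cong (i ∷ is) 𝓕≗𝓕′ B =
  trans (dSeq-cong is (dFam-cong i 𝓕≗𝓕′) _) (cong (dSeq is _) (dElem-cong i 𝓕≗𝓕′ B))

dSeq-suc : ∀ is (𝓖 : Family (suc n)) x B → dSeq (map suc is) 𝓖 (x ∷ B) ≡ x ∷ dSeq is (fibre x 𝓖) B
dSeq-suc []       𝓖 x B = refl
dSeq-suc (i ∷ is) 𝓖 x B = begin
  dSeq (map suc is) (dFam (suc i) 𝓖) (dElem (suc i) 𝓖 (x ∷ B))
    ≡⟨ cong (dSeq (map suc is) (dFam (suc i) 𝓖)) (dElem-suc i 𝓖 x B) ⟩
  dSeq (map suc is) (dFam (suc i) 𝓖) (x ∷ dElem i (fibre x 𝓖) B)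
    ≡⟨ dSeq-suc is (dFam (suc i) 𝓖) x _ ⟩
  x ∷ dSeq is (fibre x (dFam (suc i) 𝓖)) (dElem i (fibre x 𝓖) B)
    ≡⟨ cong (x ∷_) (dSeq-cong is (fibre-dFam-suc i x 𝓖) _) ⟩
  x ∷ dSeq is (dFam i (fibre x 𝓖)) (dElem i (fibre x 𝓖) B) ∎
  where open ≡-Reasoning

toList-allFin-suc : ∀ n → toList (allFin (suc n)) ≡ zero ∷ map suc (toList (allFin n))
toList-allFin-suc n = cong (zero ∷_) (trans (cong toList (tabulate-∘ suc id)) (toList-map suc (allFin n)))

dB-cons : ∀ (𝓖 : Family (suc n)) B x C → dElem zero 𝓖 B ≡ x ∷ C → dB 𝓖 B ≡ x ∷ dB (compressedFibre x 𝓖) C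
dB-cons {n} 𝓖 B x C d₁B≡x∷C = begin
  dSeq (toList (allFin (suc n))) 𝓖 B                     ≡⟨ cong (λ is → dSeq is 𝓖 B) (toList-allFin-suc n) ⟩
  dSeq (map suc indices) (dFam zero 𝓖) (dElem zero 𝓖 B) ≡⟨ cong (dSeq (map suc indices) (dFam zero 𝓖)) d₁B≡x∷C ⟩
  dSeq (map suc indices) (dFam zero 𝓖) (x ∷ C)          ≡⟨ dSeq-suc indices (dFam zero 𝓖) x C ⟩
  x ∷ dSeq indices (fibre x (dFam zero 𝓖)) C            ≡⟨ cong (x ∷_) (dSeq-cong indices (fibre-dFam-zero x 𝓖) C) ⟩
  x ∷ dB (compressedFibre x 𝓖) C                         ∎
  where
  open ≡-Reasoning
  indices = toList (allFin n)

dB-outside : ∀ (𝓖 : Family (suc n)) C → dB 𝓖 (outside ∷ C) ≡ outside ∷ dB (fibreUnion 𝓖) C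
dB-outside 𝓖 C = dB-cons 𝓖 (outside ∷ C) outside C refl

dB-inside-kept : ∀ (𝓖 : Family (suc n)) C → 𝓖 (outside ∷ C) ≡ true →
  dB 𝓖 (inside ∷ C) ≡ inside ∷ dB (fibreInter 𝓖) C
dB-inside-kept 𝓖 C C∈𝓖 =
  dB-cons 𝓖 (inside ∷ C) inside C (trans (dElem-zero-inside 𝓖 C) (if-cong C∈𝓖))

dB-inside-moved : ∀ (𝓖 : Family (suc n)) C → 𝓖 (outside ∷ C) ≡ false →
  dB 𝓖 (inside ∷ C) ≡ outside ∷ dB (fibreUnion 𝓖) C
dB-inside-moved 𝓖 C C∉𝓖 =
  dB-cons 𝓖 (inside ∷ C) outside C (trans (dElem-zero-inside 𝓖 C) (if-cong C∉𝓖))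

-- Simply rooted families

∨-introʳ : ∀ a {b} → b ≡ true → a ∨ b ≡ true
∨-introʳ a b≡true = trans (cong (a ∨_) b≡true) (∨-zeroʳ a)

SimplyRooted-fibreUnion : ∀ {𝓖 : Family (suc n)} → SimplyRooted 𝓖 → SimplyRooted (fibreUnion 𝓖)
SimplyRooted-fibreUnion {𝓖 = 𝓖} rooted B B∈𝓤 (j , j∈B) with 𝓖 (outside ∷ B) in B∈𝓖
... | true with rooted (outside ∷ B) B∈𝓖 (suc j , there j∈B)
...   | suc b , there b∈B , above =
  b , b∈B , λ C b∈C C⊆B → cong (_∨ 𝓖 (inside ∷ C)) (above (outside ∷ C) (there b∈C) (out⊆ C⊆B))
SimplyRooted-fibreUnion {𝓖 = 𝓖} rooted B B∈𝓤 (j , j∈B) | false with rooted (inside ∷ B) B∈𝓤 (zero , here)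
... | zero , _ , above =
  j , j∈B , λ C _ C⊆B → ∨-introʳ (𝓖 (outside ∷ C)) (above (inside ∷ C) here (s⊆s C⊆B))
... | suc b , there b∈B , above =
  b , b∈B , λ C b∈C C⊆B → ∨-introʳ (𝓖 (outside ∷ C)) (above (inside ∷ C) (there b∈C) (s⊆s C⊆B))

SimplyRooted-fibreInter : ∀ {𝓖 : Family (suc n)} → SimplyRooted 𝓖 → SimplyRooted (fibreInter 𝓖)
SimplyRooted-fibreInter {𝓖 = 𝓖} rooted B B∈𝓝 (j , j∈B)
  with rooted (outside ∷ B) (∧-conicalˡ _ _ B∈𝓝) (suc j , there j∈B)
     | rooted (inside ∷ B) (∧-conicalʳ (𝓖 (outside ∷ B)) _ B∈𝓝) (zero , here)
... | suc b , there b∈B , above₀ | zero , _ , above₁ =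
  b , b∈B , λ C b∈C C⊆B → cong₂ _∧_ (above₀ (outside ∷ C) (there b∈C) (out⊆ C⊆B))
                                    (above₁ (inside ∷ C) here (s⊆s C⊆B))
... | _ | suc b , there b∈B , above₁ =
  b , b∈B , λ C b∈C C⊆B → cong₂ _∧_ (above₁ (outside ∷ C) (there b∈C) (out⊆ C⊆B))
                                    (above₁ (inside ∷ C) (there b∈C) (s⊆s C⊆B))

dB-fixes-down-closed : ∀ n (𝓕 : Family n) C → (∀ D → D ⊆ C → 𝓕 D ≡ true) → dB 𝓕 C ≡ C
dB-fixes-down-closed zero    𝓕 []          _     = refl
dB-fixes-down-closed (suc n) 𝓕 (false ∷ C) ↓C⊆𝓕 =
  trans (dB-outside 𝓕 C)
        (cong (outside ∷_) (dB-fixes-down-closed n _ C λ D D⊆C →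
          cong (_∨ 𝓕 (inside ∷ D)) (↓C⊆𝓕 (outside ∷ D) (out⊆ D⊆C))))
dB-fixes-down-closed (suc n) 𝓕 (true ∷ C)  ↓C⊆𝓕 =
  trans (dB-inside-kept 𝓕 C (↓C⊆𝓕 (outside ∷ C) (out⊆ ⊆-refl)))
        (cong (inside ∷_) (dB-fixes-down-closed n _ C λ D D⊆C →
          cong₂ _∧_ (↓C⊆𝓕 (outside ∷ D) (out⊆ D⊆C)) (↓C⊆𝓕 (inside ∷ D) (s⊆s D⊆C))))

-- The root of {1} ∪ C must be 1, since otherwise C itself would lie in 𝓖.
dB-fixes-moved : ∀ {𝓖 : Family (suc n)} → SimplyRooted 𝓖 → ∀ C →
  𝓖 (inside ∷ C) ≡ true → 𝓖 (outside ∷ C) ≡ false → dB (fibreUnion 𝓖) C ≡ C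
dB-fixes-moved {𝓖 = 𝓖} rooted C iC∈𝓖 C∉𝓖 with rooted (inside ∷ C) iC∈𝓖 (zero , here)
... | zero , _ , above =
  dB-fixes-down-closed _ _ C λ D D⊆C → ∨-introʳ (𝓖 (outside ∷ D)) (above (inside ∷ D) here (s⊆s D⊆C))
... | suc b , there b∈C , above with () ← trans (sym C∉𝓖) (above (outside ∷ C) (there b∈C) (out⊆ ⊆-refl))

-- Colex initial segments

-- Coordinate i carries weight 2^i: the colex order is the order of binary values (#-colexLt),
-- so colexInitial n m consists of the first m subsets of [n] when m ≤ 2^n.
binary : Subset n → ℕ
binary []      = 0
binary (x ∷ C) = (if x then 1 else 0) + 2 * binary C

colexLt-irrefl : ∀ (C : Subset n) → colexLt C C ≡ false
colexLt-irrefl []      = refl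
colexLt-irrefl (x ∷ C) with C =ˢ C | x
... | true  | false = refl
... | true  | true  = refl
... | false | _     = colexLt-irrefl C

#-override : ∀ (𝓠 : Family n) C b → 𝓠 C ≡ false →
  # (λ G → if G =ˢ C then b else 𝓠 G) ≡ (if b then 1 else 0) + # 𝓠
#-override {n} 𝓠 C b C∉𝓠 = trans (cubeSum-+ n pointwise) (cong (_+ # 𝓠) (cubeSum-=ˢ C _))
  where
  pointwise : ∀ G → (if (if G =ˢ C then b else 𝓠 G) then 1 else 0)
                  ≡ (if G =ˢ C then (if b then 1 else 0) else 0) + (if 𝓠 G then 1 else 0)
  pointwise G with G =ˢ C in G=C
  ... | true rewrite =ˢ⇒≡ G C G=C | C∉𝓠 = sym (+-identityʳ _)
  ... | false = refl

#-colexLt : ∀ (C : Subset n) → # (λ G → colexLt G C) ≡ binary C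
#-colexLt []      = refl
#-colexLt (y ∷ C) = begin
  # (λ G → if G =ˢ C then y else colexLt G C) + # (λ G → if G =ˢ C then false else colexLt G C)
    ≡⟨ cong₂ _+_ (#-override _ C y (colexLt-irrefl C)) (#-override _ C false (colexLt-irrefl C)) ⟩
  (if y then 1 else 0) + # (λ G → colexLt G C) + # (λ G → colexLt G C)
    ≡⟨ cong (λ k → (if y then 1 else 0) + k + k) (#-colexLt C) ⟩
  (if y then 1 else 0) + binary C + binary C
    ≡⟨ +-assoc (if y then 1 else 0) (binary C) _ ⟩
  (if y then 1 else 0) + (binary C + binary C)
    ≡⟨ cong (λ k → (if y then 1 else 0) + (binary C + k)) (sym (+-identityʳ (binary C))) ⟩
  binary (y ∷ C) ∎
  where open ≡-Reasoning

colexInitial : ∀ n → ℕ → Family n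
colexInitial n m C = binary C <ᵇ m

colexWeight : ℕ → ℕ → ℕ
colexWeight n m = ‖ colexInitial n m ‖

<ᵇ-cong : ∀ {v x w y} → (v < x → w < y) → (w < y → v < x) → (v <ᵇ x) ≡ (w <ᵇ y)
<ᵇ-cong {v} {x} {w} {y} ⇒ ⇐ = det (<ᵇ-reflects-< v x) (fromEquivalence (⇐ ∘ <ᵇ⇒< w y) (<⇒<ᵇ ∘ ⇒))

2*<ᵇ2* : ∀ v x → (2 * v <ᵇ 2 * x) ≡ (v <ᵇ x)
2*<ᵇ2* v x = <ᵇ-cong (*-cancelˡ-< 2 v x) (*-monoʳ-< 2)

1+2*<ᵇ2* : ∀ v x → (suc (2 * v) <ᵇ 2 * x) ≡ (v <ᵇ x)
1+2*<ᵇ2* v x = <ᵇ-cong (*-cancelˡ-< 2 v x ∘ <⇒≤) (subst (_≤ 2 * x) (*-suc 2 v) ∘ *-monoʳ-≤ 2)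

2*<ᵇ1+2* : ∀ v x → (2 * v <ᵇ suc (2 * x)) ≡ (v <ᵇ suc x)
2*<ᵇ1+2* v x = <ᵇ-cong {2 * v} {suc (2 * x)} {v} {suc x}
  (λ 2v≤2x → s≤s (*-cancelˡ-≤ 2 (s≤s⁻¹ 2v≤2x))) (λ v≤x → s≤s (*-monoʳ-≤ 2 (s≤s⁻¹ v≤x)))

data EvenOdd : ℕ → Set where
  even : ∀ x → EvenOdd (2 * x)
  odd  : ∀ x → EvenOdd (suc (2 * x))

evenOdd : ∀ m → EvenOdd m
evenOdd zero    = even 0
evenOdd (suc m) with evenOdd m
... | even x = odd x
... | odd x  = subst EvenOdd (*-suc 2 x) (even (suc x))

x+x≡2*x : ∀ x → x + x ≡ 2 * x
x+x≡2*x x = cong (x +_) (sym (+-identityʳ x))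

module _ {n : ℕ} (x : ℕ) where

  colexInitial-even₀ : fibre outside (colexInitial (suc n) (2 * x)) ≗ colexInitial n x
  colexInitial-even₀ C = 2*<ᵇ2* (binary C) x

  colexInitial-even₁ : fibre inside (colexInitial (suc n) (2 * x)) ≗ colexInitial n x
  colexInitial-even₁ C = 1+2*<ᵇ2* (binary C) x

  colexInitial-odd₀ : fibre outside (colexInitial (suc n) (suc (2 * x))) ≗ colexInitial n (suc x)
  colexInitial-odd₀ C = 2*<ᵇ1+2* (binary C) x

  colexInitial-odd₁ : fibre inside (colexInitial (suc n) (suc (2 * x))) ≗ colexInitial n x
  colexInitial-odd₁ C = 2*<ᵇ2* (binary C) x

#-colexInitial : ∀ n m → m ≤ 2 ^ n → # (colexInitial n m) ≡ m
#-colexInitial zero    zero          _ = refl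
#-colexInitial zero    (suc zero)    _ = refl
#-colexInitial zero    (suc (suc m)) (s≤s ())
#-colexInitial (suc n) m m≤2^n with evenOdd m
... | even x = begin
  # (colexInitial (suc n) (2 * x))
    ≡⟨ #-fibres (colexInitial (suc n) (2 * x)) (colexInitial-even₀ x) (colexInitial-even₁ x) ⟩
  # (colexInitial n x) + # (colexInitial n x)
    ≡⟨ cong₂ _+_ (#-colexInitial n x x≤2^n) (#-colexInitial n x x≤2^n) ⟩
  x + x
    ≡⟨ x+x≡2*x x ⟩
  2 * x ∎
  where
  open ≡-Reasoning
  x≤2^n = *-cancelˡ-≤ 2 m≤2^n
... | odd x = begin
  # (colexInitial (suc n) (suc (2 * x)))
    ≡⟨ #-fibres (colexInitial (suc n) (suc (2 * x))) (colexInitial-odd₀ x) (colexInitial-odd₁ x) ⟩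
  # (colexInitial n (suc x)) + # (colexInitial n x)
    ≡⟨ cong₂ _+_ (#-colexInitial n (suc x) x<2^n) (#-colexInitial n x (<⇒≤ x<2^n)) ⟩
  suc x + x
    ≡⟨ cong suc (x+x≡2*x x) ⟩
  suc (2 * x) ∎
  where
  open ≡-Reasoning
  x<2^n = *-cancelˡ-< 2 x (2 ^ n) m≤2^n

colexWeight-even : ∀ n x → x ≤ 2 ^ n → colexWeight (suc n) (2 * x) ≡ colexWeight n x + colexWeight n x + x
colexWeight-even n x x≤2^n =
  trans (‖‖-fibres (colexInitial (suc n) (2 * x)) (colexInitial-even₀ x) (colexInitial-even₁ x))
        (trans (cong (λ k → colexWeight n x + (colexWeight n x + k)) (#-colexInitial n x x≤2^n))
               (sym (+-assoc (colexWeight n x) _ x)))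

colexWeight-odd : ∀ n x → suc x ≤ 2 ^ n →
  colexWeight (suc n) (suc (2 * x)) ≡ colexWeight n (suc x) + colexWeight n x + x
colexWeight-odd n x x<2^n =
  trans (‖‖-fibres (colexInitial (suc n) (suc (2 * x))) (colexInitial-odd₀ x) (colexInitial-odd₁ x))
        (trans (cong (λ k → colexWeight n (suc x) + (colexWeight n x + k)) (#-colexInitial n x (<⇒≤ x<2^n)))
               (sym (+-assoc (colexWeight n (suc x)) _ x)))

2^n≤2^1+n : ∀ n → 2 ^ n ≤ 2 ^ suc n
2^n≤2^1+n n = m≤n*m (2 ^ n) 2

colexWeight-suc : ∀ n m → m ≤ 2 ^ n → colexWeight (suc n) m ≡ colexWeight n m
colexWeight-suc zero    zero       _ = refl
colexWeight-suc zero    (suc zero) _ = refl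
colexWeight-suc zero    (suc (suc m)) (s≤s ())
colexWeight-suc (suc n) m m≤2^n with evenOdd m
... | even x = begin
  colexWeight (2 + n) (2 * x)                       ≡⟨ colexWeight-even (suc n) x (≤-trans x≤2^n (2^n≤2^1+n n)) ⟩
  colexWeight (suc n) x + colexWeight (suc n) x + x ≡⟨ cong (λ k → k + k + x) (colexWeight-suc n x x≤2^n) ⟩
  colexWeight n x + colexWeight n x + x             ≡⟨ colexWeight-even n x x≤2^n ⟨
  colexWeight (suc n) (2 * x)                       ∎
  where
  open ≡-Reasoning
  x≤2^n = *-cancelˡ-≤ 2 m≤2^n
... | odd x = begin
  colexWeight (2 + n) (suc (2 * x))                 ≡⟨ colexWeight-odd (suc n) x (≤-trans x<2^n (2^n≤2^1+n n)) ⟩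
  colexWeight (suc n) (suc x) + colexWeight (suc n) x + x
    ≡⟨ cong₂ (λ k l → k + l + x) (colexWeight-suc n (suc x) x<2^n) (colexWeight-suc n x (<⇒≤ x<2^n)) ⟩
  colexWeight n (suc x) + colexWeight n x + x       ≡⟨ colexWeight-odd n x x<2^n ⟨
  colexWeight (suc n) (suc (2 * x))                 ∎
  where
  open ≡-Reasoning
  x<2^n = *-cancelˡ-< 2 x (2 ^ n) m≤2^n

⌈2*x/2⌉≡x : ∀ x → ⌈ 2 * x /2⌉ ≡ x
⌈2*x/2⌉≡x x = sym (trans (n≡⌈n+n/2⌉ x) (cong ⌈_/2⌉ (x+x≡2*x x)))

⌈/2⌉-≤ : ∀ {c x} → c ≤ 2 * x → ⌈ c /2⌉ ≤ x
⌈/2⌉-≤ {x = x} c≤2x = ≤-trans (⌈n/2⌉-mono c≤2x) (≤-reflexive (⌈2*x/2⌉≡x x))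

⌊/2⌋-≤ : ∀ {c x} → c ≤ suc (2 * x) → ⌊ c /2⌋ ≤ x
⌊/2⌋-≤ {x = x} c≤1+2x = ≤-trans (⌊n/2⌋-mono c≤1+2x) (≤-reflexive (⌈2*x/2⌉≡x x))

≤2*⌈/2⌉ : ∀ c → c ≤ 2 * ⌈ c /2⌉
≤2*⌈/2⌉ c = begin
  c                       ≡⟨ ⌊n/2⌋+⌈n/2⌉≡n c ⟨
  ⌊ c /2⌋ + ⌈ c /2⌉       ≤⟨ +-monoˡ-≤ ⌈ c /2⌉ (⌊n/2⌋≤⌈n/2⌉ c) ⟩
  ⌈ c /2⌉ + ⌈ c /2⌉       ≡⟨ x+x≡2*x ⌈ c /2⌉ ⟩
  2 * ⌈ c /2⌉             ∎
  where open ≤-Reasoning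

≤1+2*⌊/2⌋ : ∀ c → c ≤ suc (2 * ⌊ c /2⌋)
≤1+2*⌊/2⌋ c = begin
  c                       ≡⟨ ⌊n/2⌋+⌈n/2⌉≡n c ⟨
  ⌊ c /2⌋ + ⌈ c /2⌉       ≤⟨ +-monoʳ-≤ ⌊ c /2⌋ (⌈n/2⌉≤1+⌊n/2⌋ c) ⟩
  ⌊ c /2⌋ + suc ⌊ c /2⌋   ≡⟨ +-suc ⌊ c /2⌋ _ ⟩
  suc (⌊ c /2⌋ + ⌊ c /2⌋) ≡⟨ cong suc (x+x≡2*x ⌊ c /2⌋) ⟩
  suc (2 * ⌊ c /2⌋)       ∎
  where
  open ≤-Reasoning
  ⌈n/2⌉≤1+⌊n/2⌋ : ∀ n → ⌈ n /2⌉ ≤ suc ⌊ n /2⌋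
  ⌈n/2⌉≤1+⌊n/2⌋ 0             = z≤n
  ⌈n/2⌉≤1+⌊n/2⌋ 1             = ≤-refl
  ⌈n/2⌉≤1+⌊n/2⌋ (suc (suc n)) = s≤s (⌈n/2⌉≤1+⌊n/2⌋ n)

Superadditive : ℕ → Set
Superadditive n = ∀ a b {c} → c ≤ a → c ≤ b → a + b ≤ 2 ^ n →
  colexWeight n a + colexWeight n b + c ≤ colexWeight n (a + b)

-- Each case pairs a half of a with a half of b so that the two pair sums are the halves of a + b,
-- and splits c between the two pairs.
module SuperadditiveStep (n : ℕ) (ih : Superadditive n) where

  private
    W W′ : ℕ → ℕ
    W  = colexWeight n
    W′ = colexWeight (suc n)

    ih-suc : ∀ x y {c} → c ≤ x → c ≤ suc y → suc (x + y) ≤ 2 ^ n → W x + W (suc y) + c ≤ W (suc (x + y))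
    ih-suc x y c≤x c≤1+y bound =
      subst (W x + W (suc y) + _ ≤_) (cong W (+-suc x y))
            (ih x (suc y) c≤x c≤1+y (subst (_≤ 2 ^ n) (sym (+-suc x y)) bound))

  even-even : ∀ x y {c} → c ≤ 2 * x → c ≤ 2 * y → 2 * x + 2 * y ≤ 2 ^ suc n →
    W′ (2 * x) + W′ (2 * y) + c ≤ W′ (2 * x + 2 * y)
  even-even x y {c} c≤2x c≤2y bound = begin
    W′ (2 * x) + W′ (2 * y) + c
      ≡⟨ cong₂ (λ k l → k + l + c) (colexWeight-even n x x≤2^n) (colexWeight-even n y y≤2^n) ⟩
    (W x + W x + x) + (W y + W y + y) + c
      ≤⟨ +-monoʳ-≤ ((W x + W x + x) + (W y + W y + y)) (≤2*⌈/2⌉ c) ⟩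
    (W x + W x + x) + (W y + W y + y) + 2 * h
      ≡⟨ regroup (W x) (W y) x y h ⟩
    (W x + W y + h) + (W x + W y + h) + (x + y)
      ≤⟨ +-monoˡ-≤ (x + y) (+-mono-≤ halves halves) ⟩
    W (x + y) + W (x + y) + (x + y)
      ≡⟨ colexWeight-even n (x + y) s≤2^n ⟨
    W′ (2 * (x + y))
      ≡⟨ cong W′ (*-distribˡ-+ 2 x y) ⟩
    W′ (2 * x + 2 * y) ∎
    where
    open ≤-Reasoning
    h = ⌈ c /2⌉
    s≤2^n : x + y ≤ 2 ^ n
    s≤2^n = *-cancelˡ-≤ 2 (subst (_≤ 2 ^ suc n) (sym (*-distribˡ-+ 2 x y)) bound)
    x≤2^n = ≤-trans (m≤m+n x y) s≤2^n
    y≤2^n = ≤-trans (m≤n+m y x) s≤2^n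
    halves : W x + W y + h ≤ W (x + y)
    halves = ih x y (⌈/2⌉-≤ c≤2x) (⌈/2⌉-≤ c≤2y) s≤2^n
    regroup : ∀ u v x y h → (u + u + x) + (v + v + y) + 2 * h ≡ (u + v + h) + (u + v + h) + (x + y)
    regroup = solve-∀

  odd-odd : ∀ x y {c} → c ≤ suc (2 * x) → c ≤ suc (2 * y) → suc (2 * x) + suc (2 * y) ≤ 2 ^ suc n →
    W′ (suc (2 * x)) + W′ (suc (2 * y)) + c ≤ W′ (suc (2 * x) + suc (2 * y))
  odd-odd x y {c} c≤a c≤b bound = begin
    W′ (suc (2 * x)) + W′ (suc (2 * y)) + c
      ≡⟨ cong₂ (λ k l → k + l + c) (colexWeight-odd n x (≤-trans (s≤s (m≤m+n x y)) s≤2^n))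
                                    (colexWeight-odd n y (≤-trans (s≤s (m≤n+m y x)) s≤2^n)) ⟩
    (W (suc x) + W x + x) + (W (suc y) + W y + y) + c
      ≤⟨ +-monoʳ-≤ ((W (suc x) + W x + x) + (W (suc y) + W y + y)) (≤1+2*⌊/2⌋ c) ⟩
    (W (suc x) + W x + x) + (W (suc y) + W y + y) + suc (2 * q)
      ≡⟨ regroup (W (suc x)) (W x) (W (suc y)) (W y) x y q ⟩
    (W (suc x) + W y + q) + (W x + W (suc y) + q) + s
      ≤⟨ +-monoˡ-≤ s (+-mono-≤ (ih (suc x) y (m≤n⇒m≤1+n q≤x) q≤y s≤2^n)
                               (ih-suc x y q≤x (m≤n⇒m≤1+n q≤y) s≤2^n)) ⟩
    W s + W s + s
      ≡⟨ colexWeight-even n s s≤2^n ⟨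
    W′ (2 * s)
      ≡⟨ cong W′ (a+b≡2*s x y) ⟨
    W′ (suc (2 * x) + suc (2 * y)) ∎
    where
    open ≤-Reasoning
    q = ⌊ c /2⌋
    s = suc (x + y)
    a+b≡2*s : ∀ x y → suc (2 * x) + suc (2 * y) ≡ 2 * suc (x + y)
    a+b≡2*s = solve-∀
    s≤2^n : s ≤ 2 ^ n
    s≤2^n = *-cancelˡ-≤ 2 (subst (_≤ 2 ^ suc n) (a+b≡2*s x y) bound)
    q≤x = ⌊/2⌋-≤ c≤a
    q≤y = ⌊/2⌋-≤ c≤b
    regroup : ∀ u₁ u v₁ v x y q → (u₁ + u + x) + (v₁ + v + y) + suc (2 * q)
                                 ≡ (u₁ + v + q) + (u + v₁ + q) + suc (x + y)
    regroup = solve-∀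

  even-odd : ∀ x y {c} → c ≤ 2 * x → c ≤ suc (2 * y) → 2 * x + suc (2 * y) ≤ 2 ^ suc n →
    W′ (2 * x) + W′ (suc (2 * y)) + c ≤ W′ (2 * x + suc (2 * y))
  even-odd x y {c} c≤a c≤b bound = begin
    W′ (2 * x) + W′ (suc (2 * y)) + c
      ≡⟨ cong₂ (λ k l → k + l + c) (colexWeight-even n x (≤-trans (m≤m+n x y) (<⇒≤ s<2^n)))
                                    (colexWeight-odd n y (≤-trans (s≤s (m≤n+m y x)) s<2^n)) ⟩
    (W x + W x + x) + (W (suc y) + W y + y) + c
      ≡⟨ cong ((W x + W x + x) + (W (suc y) + W y + y) +_) (⌊n/2⌋+⌈n/2⌉≡n c) ⟨
    (W x + W x + x) + (W (suc y) + W y + y) + (l + h)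
      ≡⟨ regroup (W x) (W (suc y)) (W y) x y l h ⟩
    (W x + W (suc y) + h) + (W x + W y + l) + s
      ≤⟨ +-monoˡ-≤ s (+-mono-≤ (ih-suc x y h≤x h≤1+y s<2^n)
                               (ih x y l≤x l≤y (<⇒≤ s<2^n))) ⟩
    W (suc s) + W s + s
      ≡⟨ colexWeight-odd n s s<2^n ⟨
    W′ (suc (2 * s))
      ≡⟨ cong W′ (a+b≡1+2*s x y) ⟨
    W′ (2 * x + suc (2 * y)) ∎
    where
    open ≤-Reasoning
    l = ⌊ c /2⌋
    h = ⌈ c /2⌉
    s = x + y
    a+b≡1+2*s : ∀ x y → 2 * x + suc (2 * y) ≡ suc (2 * (x + y))
    a+b≡1+2*s = solve-∀
    s<2^n : suc s ≤ 2 ^ n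
    s<2^n = *-cancelˡ-< 2 s (2 ^ n) (subst (_≤ 2 ^ suc n) (a+b≡1+2*s x y) bound)
    h≤x = ⌈/2⌉-≤ c≤a
    h≤1+y = ⌈/2⌉-≤ (≤-trans c≤b (subst (suc (2 * y) ≤_) (sym (*-suc 2 y)) (n≤1+n _)))
    l≤x = ≤-trans (⌊n/2⌋≤⌈n/2⌉ c) h≤x
    l≤y = ⌊/2⌋-≤ c≤b
    regroup : ∀ u v₁ v x y l h → (u + u + x) + (v₁ + v + y) + (l + h)
                                ≡ (u + v₁ + h) + (u + v + l) + (x + y)
    regroup = solve-∀

  step : Superadditive (suc n)
  step a b {c} c≤a c≤b bound with evenOdd a | evenOdd b
  ... | even x | even y = even-even x y c≤a c≤b bound
  ... | odd x  | odd y  = odd-odd x y c≤a c≤b bound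
  ... | even x | odd y  = even-odd x y c≤a c≤b bound
  ... | odd x  | even y =
    subst₂ _≤_ (cong (_+ c) (+-comm (W′ (2 * y)) (W′ (suc (2 * x)))))
               (cong W′ (+-comm (2 * y) (suc (2 * x))))
           (even-odd y x c≤b c≤a (subst (_≤ 2 ^ suc n) (+-comm (suc (2 * x)) _) bound))

colexWeight-superadditive : ∀ n → Superadditive n
colexWeight-superadditive zero a b {zero} _ _ _
  rewrite if-eta {A = ℕ} (0 <ᵇ a) {0} | if-eta {A = ℕ} (0 <ᵇ b) {0} = z≤n
colexWeight-superadditive zero (suc a) (suc b) {suc c} _ _ (s≤s a+1+b≤0)
  with () ← ≤-trans (m≤n+m (suc b) a) a+1+b≤0
colexWeight-superadditive (suc n) = SuperadditiveStep.step n (colexWeight-superadditive n)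

m≤2^m : ∀ m → m ≤ 2 ^ m
m≤2^m zero    = z≤n
m≤2^m (suc m) = begin
  suc m           ≤⟨ s≤s (m≤2^m m) ⟩
  1 + 2 ^ m       ≤⟨ +-monoˡ-≤ (2 ^ m) (m^n>0 2 m) ⟩
  2 ^ m + 2 ^ m   ≡⟨ x+x≡2*x (2 ^ m) ⟩
  2 ^ suc m       ∎
  where open ≤-Reasoning

colexWeight-stable : ∀ {n n′ m} → n ≤′ n′ → m ≤ 2 ^ n → colexWeight n′ m ≡ colexWeight n m
colexWeight-stable                 ≤′-refl           _      = refl
colexWeight-stable {n} {suc n′} {m} (≤′-step n≤′n′) m≤2^n =
  trans (colexWeight-suc n′ m (≤-trans m≤2^n (^-monoʳ-≤ 2 (≤′⇒≤ n≤′n′)))) (colexWeight-stable n≤′n′ m≤2^n)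

weightI≡colexWeight : ∀ m n → m ≤ n → weightI m ≡ colexWeight n m
weightI≡colexWeight m n m≤n = begin
  weight (I m)             ≡⟨ weight≡‖‖ (I m) ⟩
  ‖ I m ‖                  ≡⟨ sumOver-cong ∣_∣ I≗colexInitial ⟩
  colexWeight m m          ≡⟨ colexWeight-stable (≤⇒≤′ m≤n) (m≤2^m m) ⟨
  colexWeight n m          ∎
  where
  open ≡-Reasoning
  I≗colexInitial : I m ≗ colexInitial m m
  I≗colexInitial F = cong (_<ᵇ m) (trans (count≡# (λ G → colexLt G F)) (#-colexLt F))

weightI-superadditive : ∀ a b {c} → c ≤ a → c ≤ b → weightI a + weightI b + c ≤ weightI (a + b)
weightI-superadditive a b {c} c≤a c≤b = begin
  weightI a + weightI b + c
    ≡⟨ cong₂ (λ k l → k + l + c) (weightI≡colexWeight a (a + b) (m≤m+n a b))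
                                  (weightI≡colexWeight b (a + b) (m≤n+m b a)) ⟩
  colexWeight (a + b) a + colexWeight (a + b) b + c
    ≤⟨ colexWeight-superadditive (a + b) a b c≤a c≤b (m≤2^m (a + b)) ⟩
  colexWeight (a + b) (a + b)
    ≡⟨ weightI≡colexWeight (a + b) (a + b) ≤-refl ⟨
  weightI (a + b) ∎
  where open ≤-Reasoning

-- Fixed points of d_𝓑

fixedPoints : Family n → Family n
fixedPoints 𝓑 B = 𝓑 B ∧ (dB 𝓑 B =ˢ B)

#fixedPoints≤# : ∀ (𝓑 : Family n) → # (fixedPoints 𝓑) ≤ # 𝓑
#fixedPoints≤# 𝓑 = sumOver-mono _ λ B → ∧-conicalˡ (𝓑 B) _

#-fixedPoints-compress : ∀ {𝓖 : Family (suc n)} → SimplyRooted 𝓖 →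
  # (fixedPoints 𝓖) + # (moved 𝓖) ≡ # (fixedPoints (fibreUnion 𝓖)) + # (fixedPoints (fibreInter 𝓖))
#-fixedPoints-compress {n} {𝓖} rooted = begin
  # (fixedPoints 𝓖) + # (moved 𝓖)
    ≡⟨ cong (_+ # (moved 𝓖)) (#-fibres (fixedPoints 𝓖) fixed₀ fixed₁) ⟩
  # keptFixed + # (fixedPoints 𝓝) + # (moved 𝓖)
    ≡⟨ xy∙z≈xz∙y (# keptFixed) _ _ ⟩
  # keptFixed + # (moved 𝓖) + # (fixedPoints 𝓝)
    ≡⟨ cong (_+ # (fixedPoints 𝓝)) split ⟨
  # (fixedPoints 𝓤) + # (fixedPoints 𝓝) ∎
  where
  open ≡-Reasoning
  𝓤 𝓝 keptFixed : Family n
  𝓤 = fibreUnion 𝓖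
  𝓝 = fibreInter 𝓖
  keptFixed C = 𝓖 (outside ∷ C) ∧ (dB 𝓤 C =ˢ C)
  fixed₀ : fibre outside (fixedPoints 𝓖) ≗ keptFixed
  fixed₀ C = cong (λ E → 𝓖 (outside ∷ C) ∧ (E =ˢ (outside ∷ C))) (dB-outside 𝓖 C)
  fixed₁ : fibre inside (fixedPoints 𝓖) ≗ fixedPoints 𝓝
  fixed₁ C with 𝓖 (outside ∷ C) in C∈𝓖
  ... | true  = cong (λ E → 𝓖 (inside ∷ C) ∧ (E =ˢ (inside ∷ C))) (dB-inside-kept 𝓖 C C∈𝓖)
  ... | false = trans (cong (λ E → 𝓖 (inside ∷ C) ∧ (E =ˢ (inside ∷ C))) (dB-inside-moved 𝓖 C C∈𝓖))
                      (∧-zeroʳ (𝓖 (inside ∷ C)))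
  kept : (λ C → fixedPoints 𝓤 C ∧ 𝓖 (outside ∷ C)) ≗ keptFixed
  kept C with 𝓖 (outside ∷ C)
  ... | true  = ∧-identityʳ _
  ... | false = ∧-zeroʳ _
  movedFixed : (λ C → fixedPoints 𝓤 C ∧ not (𝓖 (outside ∷ C))) ≗ moved 𝓖
  movedFixed C with 𝓖 (outside ∷ C) in C∉𝓖 | 𝓖 (inside ∷ C) in 1C∈𝓖
  ... | true  | b     = trans (∧-zeroʳ _) (sym (∧-zeroʳ b))
  ... | false | false = refl
  ... | false | true  rewrite dB-fixes-moved rooted C 1C∈𝓖 C∉𝓖 | =ˢ-refl C = refl
  split : # (fixedPoints 𝓤) ≡ # keptFixed + # (moved 𝓖)
  split = trans (sumOver-split (fixedPoints 𝓤) (fibre outside 𝓖) _)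
                (cong₂ _+_ (sumOver-cong _ kept) (sumOver-cong _ movedFixed))

‖‖+#fixedPoints-compress : ∀ {𝓖 : Family (suc n)} → SimplyRooted 𝓖 →
  ‖ 𝓖 ‖ + # (fixedPoints 𝓖)
    ≡ (‖ fibreUnion 𝓖 ‖ + # (fixedPoints (fibreUnion 𝓖)))
      + (‖ fibreInter 𝓖 ‖ + # (fixedPoints (fibreInter 𝓖))) + # (fibreInter 𝓖)
‖‖+#fixedPoints-compress {𝓖 = 𝓖} rooted = begin
  ‖ 𝓖 ‖ + # (fixedPoints 𝓖)
    ≡⟨ cong (_+ # (fixedPoints 𝓖)) (‖‖-compress 𝓖) ⟩
  ‖ 𝓤 ‖ + ‖ 𝓝 ‖ + (# 𝓝 + # (moved 𝓖)) + # (fixedPoints 𝓖)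
    ≡⟨ regroup (‖ 𝓤 ‖) (‖ 𝓝 ‖) (# 𝓝) (# (moved 𝓖)) (# (fixedPoints 𝓖)) ⟩
  ‖ 𝓤 ‖ + ‖ 𝓝 ‖ + # 𝓝 + (# (fixedPoints 𝓖) + # (moved 𝓖))
    ≡⟨ cong (‖ 𝓤 ‖ + ‖ 𝓝 ‖ + # 𝓝 +_) (#-fixedPoints-compress rooted) ⟩
  ‖ 𝓤 ‖ + ‖ 𝓝 ‖ + # 𝓝 + (# (fixedPoints 𝓤) + # (fixedPoints 𝓝))
    ≡⟨ regroup′ (‖ 𝓤 ‖) (‖ 𝓝 ‖) (# 𝓝) (# (fixedPoints 𝓤)) (# (fixedPoints 𝓝)) ⟩
  (‖ 𝓤 ‖ + # (fixedPoints 𝓤)) + (‖ 𝓝 ‖ + # (fixedPoints 𝓝)) + # 𝓝 ∎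
  where
  open ≡-Reasoning
  𝓤 𝓝 : Family _
  𝓤 = fibreUnion 𝓖
  𝓝 = fibreInter 𝓖
  regroup : ∀ u v b r f → u + v + (b + r) + f ≡ u + v + b + (f + r)
  regroup = solve-∀
  regroup′ : ∀ u v b f g → u + v + b + (f + g) ≡ (u + f) + (v + g) + b
  regroup′ = solve-∀

‖‖+#fixedPoints≤weightI+# : ∀ n (𝓖 : Family n) → SimplyRooted 𝓖 →
  ‖ 𝓖 ‖ + # (fixedPoints 𝓖) ≤ weightI (# 𝓖) + # 𝓖
‖‖+#fixedPoints≤weightI+# zero    𝓖 _      = begin
  ‖ 𝓖 ‖ + # (fixedPoints 𝓖) ≡⟨ cong (_+ # (fixedPoints 𝓖)) (if-eta (𝓖 [])) ⟩
  # (fixedPoints 𝓖)         ≤⟨ #fixedPoints≤# 𝓖 ⟩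
  # 𝓖                       ≤⟨ m≤n+m (# 𝓖) _ ⟩
  weightI (# 𝓖) + # 𝓖       ∎
  where open ≤-Reasoning
‖‖+#fixedPoints≤weightI+# (suc n) 𝓖 rooted = begin
  ‖ 𝓖 ‖ + # (fixedPoints 𝓖)
    ≡⟨ ‖‖+#fixedPoints-compress rooted ⟩
  (‖ 𝓤 ‖ + # (fixedPoints 𝓤)) + (‖ 𝓝 ‖ + # (fixedPoints 𝓝)) + b
    ≤⟨ +-monoˡ-≤ b (+-mono-≤ (‖‖+#fixedPoints≤weightI+# n 𝓤 (SimplyRooted-fibreUnion rooted))
                             (‖‖+#fixedPoints≤weightI+# n 𝓝 (SimplyRooted-fibreInter rooted))) ⟩
  (weightI a + a) + (weightI b + b) + b
    ≡⟨ regroup (weightI a) (weightI b) a b ⟩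
  weightI a + weightI b + b + (a + b)
    ≤⟨ +-monoˡ-≤ (a + b) (weightI-superadditive a b (#fibreInter≤#fibreUnion 𝓖) ≤-refl) ⟩
  weightI (a + b) + (a + b)
    ≡⟨ cong (λ k → weightI k + k) (#-compress 𝓖) ⟨
  weightI (# 𝓖) + # 𝓖 ∎
  where
  open ≤-Reasoning
  𝓤 𝓝 : Family n
  𝓤 = fibreUnion 𝓖
  𝓝 = fibreInter 𝓖
  a b : ℕ
  a = # 𝓤
  b = # 𝓝
  regroup : ∀ p q a b → (p + a) + (q + b) + b ≡ p + q + b + (a + b)
  regroup = solve-∀

lemma11 : (n : ℕ) (𝓑 : Family n) → SimplyRooted 𝓑 →
    weight 𝓑 ≤ weightI (card 𝓑) + (card 𝓑 ∸ count (λ B → 𝓑 B ∧ (dB 𝓑 B =ˢ B)))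
lemma11 n 𝓑 rooted = begin
  weight 𝓑
    ≡⟨ weight≡‖‖ 𝓑 ⟩
  ‖ 𝓑 ‖
    ≤⟨ m+n≤o⇒m≤o∸n ‖ 𝓑 ‖ (‖‖+#fixedPoints≤weightI+# n 𝓑 rooted) ⟩
  weightI (# 𝓑) + # 𝓑 ∸ # (fixedPoints 𝓑)
    ≡⟨ +-∸-assoc (weightI (# 𝓑)) (#fixedPoints≤# 𝓑) ⟩
  weightI (# 𝓑) + (# 𝓑 ∸ # (fixedPoints 𝓑))
    ≡⟨ cong₂ (λ k l → weightI k + (k ∸ l)) (count≡# 𝓑) (count≡# (fixedPoints 𝓑)) ⟨
  weightI (card 𝓑) + (card 𝓑 ∸ count (fixedPoints 𝓑)) ∎
  where open ≤-Reasoning
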